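{- In error-free gossip, for call sequences $\sigma$ and agents $a\in A$: (1) $\sigma\models\mathrm{Exp}_A$ iff $\sigma\models^{\mathrm{last}}\mathrm{Exp}_A$; (2) it is not the case in general that $\sigma\models K_a\mathrm{Exp}_A$ implies $\sigma\models^{\mathrm{last}}K_a\mathrm{Exp}_A$; that is, for some $A$, $\sigma$ and $a$ the former holds and the latter fails; (3) $\sigma\models^{\mathrm{last}}K_a\mathrm{Exp}_A$ implies $\sigma\models K_a\mathrm{Exp}_A$; (4) $\sigma\models^{\mathrm{last}}E_A\mathrm{Exp}_A$ implies $\sigma\models E_A\mathrm{Exp}_A$.
   Context: Error-free gossip. Fix a finite set $A$ of agents with $|A|\ge 2$. Initially each agent $a$ holds only its own secret: $\sigma_a=\{a\}$ for $\sigma=\epsilon$. A call is an ordered pair $ab$ of distinct agents ($a$ calls $b$). A call sequence is a finite sequence of calls; $\epsilon$ is the empty sequence and $\sigma.\kappa$ appends the call $\kappa$. Holdings: $\epsilon_a=\{a\}$. After a call $ab$ or $ba$, both $a$ and $b$ hold $\sigma_a\cup\sigma_b$: $(\sigma.ab)_a=(\sigma.ab)_b=\sigma_a\cup\sigma_b$. Agents not involved keep their holding. Formulas: $\varphi::=b_a\mid\neg\varphi\mid\varphi\wedge\varphi\mid K_a\varphi$. Abbreviations: - $E_A\varphi:=\bigwedge_{a\in A}K_a\varphi$; - $\mathrm{Exp}_A:=\bigwedge_{a,b\in A}b_a$. Standard semantics $\models$. $\sim_a$ is the equivalence closure of: - $\epsilon\sim_a\epsilon$; - $\sigma.ab\sim_a\tau.ab$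 iff $\sigma\sim_a\tau$ and $\sigma_b=\tau_b$, and likewise for $ba$; - $\sigma.cd\sim_a\tau.fg$ iff $\sigma\sim_a\tau$, for $c,d,f,g\neq a$. Satisfaction: $\sigma\models b_a$ iff $b\in\sigma_a$; the Boolean clauses are standard; $\sigma\models K_a\varphi$ iff $\tau\models\varphi$ for all $\tau\sim_a\sigma$. Last-call semantics $\models^{\mathrm{last}}$. For agents $a\neq c$ and a call sequence $\sigma$, let $\mathrm{last}^c_a(\sigma)$ be the pair $(X,Y)$ where, for the last call in $\sigma$ between $a$ and $c$ (in either direction), $X$ is the set of secrets $a$ held just before that call and $Y$ is the set of secrets $a$ received from $c$ in that call. If no call between $a$ and $c$ occurs in $\sigma$, then $\mathrm{last}^c_a(\sigma)=(\{a\},\emptyset)$. Let $\mathrm{last}(\sigma)_a$ be the tuple $(\mathrm{last}^c_a(\sigma))_{c\neq a}$. Satisfaction: - $\sigma\models^{\mathrm{last}}b_a$ iff $b=a$ or $b\in Y$ for some $c\neq a$ with $\mathrm{last}^c_a(\sigma)=(X,Y)$; - the Boolean clauses are standard; - $\sigma\models^{\mathrm{last}}K_a\varphi$ iff $\tau\models^{\mathrm{last}}\varphi$ for all call sequences $\tau$ with $\mathrm{last}(\tau)_a=\mathrm{last}(\sigma)_a$. -}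

module Defs where

open import Data.Nat using (ℕ; zero; suc)
open import Data.Fin using (Fin; zero; suc; _≟_)
open import Data.Fin.Subset using (Subset; ⁅_⁆; _∪_; _∈_; ⊥)
open import Data.Product using (_×_; _,_; proj₁; proj₂; ∃)
open import Data.Sum using (_⊎_)
open import Relation.Nullary using (¬_; yes; no)
open import Relation.Binary.PropositionalEquality using (_≡_; _≢_)

record Call (n : ℕ) : Set where
  constructor call
  field
    caller : Fin n
    callee : Fin n
    .distinct : caller ≢ callee
open Call public

data CallSeq (n : ℕ) : Set where
  ε   : CallSeq n
  _∙_ : CallSeq n → Call n → CallSeq n
infixl 5 _∙_

holds : {n : ℕ} → CallSeq n → Fin n → Subset n
holds ε x = ⁅ x ⁆
holds (σ ∙ call c d _) x with x ≟ c | x ≟ d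
... | yes _ | _     = holds σ c ∪ holds σ d
... | no _  | yes _ = holds σ c ∪ holds σ d
... | no _  | no _  = holds σ x

data _∼[_]_ {n : ℕ} : CallSeq n → Fin n → CallSeq n → Set where
  ∼ε     : ∀ {a} → ε ∼[ a ] ε
  ∼out   : ∀ {a σ τ b} .(p : a ≢ b) → σ ∼[ a ] τ → holds σ b ≡ holds τ b →
           (σ ∙ call a b p) ∼[ a ] (τ ∙ call a b p)
  ∼in    : ∀ {a σ τ b} .(p : b ≢ a) → σ ∼[ a ] τ → holds σ b ≡ holds τ b →
           (σ ∙ call b a p) ∼[ a ] (τ ∙ call b a p)
  ∼other : ∀ {a σ τ c d f g} .(p : c ≢ d) .(q : f ≢ g) →
           c ≢ a → d ≢ a → f ≢ a → g ≢ a → σ ∼[ a ] τ →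
           (σ ∙ call c d p) ∼[ a ] (τ ∙ call f g q)
  ∼refl  : ∀ {a σ} → σ ∼[ a ] σ
  ∼sym   : ∀ {a σ τ} → σ ∼[ a ] τ → τ ∼[ a ] σ
  ∼trans : ∀ {a σ τ ρ} → σ ∼[ a ] τ → τ ∼[ a ] ρ → σ ∼[ a ] ρ

-- Formulas φ ::= b_a | ¬φ | φ ∧ φ | K_a φ.   (sec b a) is b_a.
data Form (n : ℕ) : Set where
  sec  : Fin n → Fin n → Form n
  neg  : Form n → Form n
  _∧_  : Form n → Form n → Form n
  K    : Fin n → Form n → Form n

⋀ : {n k : ℕ} → (Fin (suc k) → Form n) → Form n
⋀ {k = zero}  f = f zero
⋀ {k = suc k} f = f zero ∧ ⋀ {k = k} (λ i → f (suc i))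

Exp : {k : ℕ} → Form (suc k)
Exp = ⋀ (λ a → ⋀ (λ b → sec b a))

E : {k : ℕ} → Form (suc k) → Form (suc k)
E φ = ⋀ (λ a → K a φ)

_⊨_ : {n : ℕ} → CallSeq n → Form n → Set
σ ⊨ sec b a = b ∈ holds σ a
σ ⊨ neg φ   = ¬ (σ ⊨ φ)
σ ⊨ (φ ∧ ψ) = (σ ⊨ φ) × (σ ⊨ ψ)
σ ⊨ K a φ   = ∀ τ → τ ∼[ a ] σ → τ ⊨ φ

-- last^c_a(σ) = (X , Y): for the last call between a and c (either
-- direction), X = holdings of a just before it, Y = holdings of c just
-- before it (what a received from c); ({a}, ∅) if there is no such call.
lastc : {n : ℕ} → CallSeq n → Fin n → Fin n → Subset n × Subset n
lastc ε a c = ⁅ a ⁆ , ⊥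
lastc (σ ∙ call x y _) a c with x ≟ a | y ≟ c | x ≟ c | y ≟ a
... | yes _ | yes _ | _     | _     = holds σ a , holds σ c
... | _     | _     | yes _ | yes _ = holds σ a , holds σ c
... | _     | _     | _     | _     = lastc σ a c

SameLast : {n : ℕ} → Fin n → CallSeq n → CallSeq n → Set
SameLast a τ σ = ∀ c → c ≢ a → lastc τ a c ≡ lastc σ a c

_⊨ˡ_ : {n : ℕ} → CallSeq n → Form n → Set
σ ⊨ˡ sec b a = b ≡ a ⊎ ∃ (λ c → c ≢ a × b ∈ proj₂ (lastc σ a c))
σ ⊨ˡ neg φ   = ¬ (σ ⊨ˡ φ)
σ ⊨ˡ (φ ∧ ψ) = (σ ⊨ˡ φ) × (σ ⊨ˡ ψ)
σ ⊨ˡ K a φ   = ∀ τ → SameLast a τ σ → τ ⊨ˡ φ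

{-# OPTIONS --safe #-}
-- Secrets travel only through calls, and whatever a learnt from c before their last call
-- c still held at that call.  So b ∈ σ_a iff b = a or b was among the secrets a received
-- in its last call with some c: the two semantics agree on every b_a, hence on Exp, and
-- a's last calls determine σ_a.  As ∼_a only matches a call of a with the same call to a
-- partner holding the same secrets, ∼_a-related sequences then have the same last calls,
-- which gives (3) and (4).  The converse fails because ∼_a also notices the calls between
-- other agents that happen after a's last call.
module Submission where

open import Defs
open import Data.Nat using (ℕ; zero; suc)
open import Data.Fin using (Fin; zero; suc; _≟_)
open import Data.Fin.Subset using (Subset; _∈_; _∉_; _∪_; _⊆_; ⊤)
open import Data.Fin.Subset.Properties
  using (p⊆p∪q; q⊆p∪q; x∈p∪q⁻; x∈⁅x⁆; x∈⁅y⁆⇒x≡y; ∉⊥; ∈⊤; ⊆-antisym)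
open import Data.Vec using (there)
open import Data.Empty using (⊥-elim)
import Data.Empty.Irrelevant as Irrelevant
open import Data.List using (List; []; _∷_)
open import Data.Maybe using (Maybe; just; nothing)
open import Data.Product using (_×_; ∃; _,_; proj₁; proj₂)
open import Data.Sum using (_⊎_; inj₁; inj₂; [_,_]′; swap; map₁)
open import Function using (_∘_)
open import Function.Bundles using (_⇔_; mk⇔; Equivalence)
open import Function.Construct.Identity using (⇔-id)
open import Relation.Nullary using (¬_; yes; no)
open import Relation.Binary.PropositionalEquality
  using (_≡_; _≢_; refl; sym; trans; cong; cong₂; subst; module ≡-Reasoning)

Party : {n : ℕ} → Fin n → Call n → Set
Party z κ = z ≡ caller κ ⊎ z ≡ callee κ

Between : {n : ℕ} → Call n → Fin n → Fin n → Set
Between κ a c = (caller κ ≡ a × callee κ ≡ c) ⊎ (caller κ ≡ c × callee κ ≡ a)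

Between⇒≢ : {n : ℕ} (κ : Call n) {a c : Fin n} → Between κ a c → c ≢ a
Between⇒≢ (call x y p) (inj₁ (x≡a , y≡c)) c≡a =
  Irrelevant.⊥-elim (p (trans x≡a (sym (trans y≡c c≡a))))
Between⇒≢ (call x y p) (inj₂ (x≡c , y≡a)) c≡a =
  Irrelevant.⊥-elim (p (trans x≡c (trans c≡a (sym y≡a))))

Between-partner-unique : {n : ℕ} (κ : Call n) {a b c : Fin n} →
  Between κ a b → Between κ a c → c ≢ a → c ≡ b
Between-partner-unique κ (inj₁ (_ , y≡b)) (inj₁ (_ , y≡c)) _ = trans (sym y≡c) y≡b
Between-partner-unique κ (inj₁ (x≡a , _)) (inj₂ (x≡c , _)) c≢a = ⊥-elim (c≢a (trans (sym x≡c) x≡a))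
Between-partner-unique κ (inj₂ (_ , y≡a)) (inj₁ (_ , y≡c)) c≢a = ⊥-elim (c≢a (trans (sym y≡c) y≡a))
Between-partner-unique κ (inj₂ (x≡b , _)) (inj₂ (x≡c , _)) _ = trans (sym x≡c) x≡b

data HoldsStep {n : ℕ} (σ : CallSeq n) (κ : Call n) (z : Fin n) : Subset n → Set where
  party    : Party z κ → HoldsStep σ κ z (holds σ (caller κ) ∪ holds σ (callee κ))
  nonparty : z ≢ caller κ → z ≢ callee κ → HoldsStep σ κ z (holds σ z)

holds-step : {n : ℕ} (σ : CallSeq n) (κ : Call n) (z : Fin n) → HoldsStep σ κ z (holds (σ ∙ κ) z)
holds-step σ (call x y p) z with z ≟ x | z ≟ y
... | yes z≡x | _       = party (inj₁ z≡x)
... | no _    | yes z≡y = party (inj₂ z≡y)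
... | no z≢x  | no z≢y  = nonparty z≢x z≢y

data LastcStep {n : ℕ} (σ : CallSeq n) (κ : Call n) (a c : Fin n) : Subset n × Subset n → Set where
  between     : Between κ a c → LastcStep σ κ a c (holds σ a , holds σ c)
  not-between : ¬ Between κ a c → LastcStep σ κ a c (lastc σ a c)

lastc-step : {n : ℕ} (σ : CallSeq n) (κ : Call n) (a c : Fin n) →
  LastcStep σ κ a c (lastc (σ ∙ κ) a c)
lastc-step σ (call x y p) a c with x ≟ a | y ≟ c | x ≟ c | y ≟ a
... | yes x≡a | yes y≡c | _       | _       = between (inj₁ (x≡a , y≡c))
... | yes _   | no y≢c  | yes x≡c | yes y≡a = between (inj₂ (x≡c , y≡a))
... | yes _   | no y≢c  | yes _   | no y≢a =
  not-between λ { (inj₁ (_ , y≡c)) → y≢c y≡c ; (inj₂ (_ , y≡a)) → y≢a y≡a }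
... | yes _   | no y≢c  | no x≢c  | _ =
  not-between λ { (inj₁ (_ , y≡c)) → y≢c y≡c ; (inj₂ (x≡c , _)) → x≢c x≡c }
... | no _    | _       | yes x≡c | yes y≡a = between (inj₂ (x≡c , y≡a))
... | no x≢a  | _       | yes _   | no y≢a =
  not-between λ { (inj₁ (x≡a , _)) → x≢a x≡a ; (inj₂ (_ , y≡a)) → y≢a y≡a }
... | no x≢a  | _       | no x≢c  | _ =
  not-between λ { (inj₁ (x≡a , _)) → x≢a x≡a ; (inj₂ (x≡c , _)) → x≢c x≡c }

holds-∙-party : {n : ℕ} (σ : CallSeq n) (κ : Call n) {z : Fin n} → Party z κ →
  holds (σ ∙ κ) z ≡ holds σ (caller κ) ∪ holds σ (callee κ)
holds-∙-party σ κ {z} z∈κ with holds (σ ∙ κ) z | holds-step σ κ z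
... | _ | party _ = refl
... | _ | nonparty z≢x z≢y = ⊥-elim ([ z≢x , z≢y ]′ z∈κ)

lastc-∙-between : {n : ℕ} (σ : CallSeq n) (κ : Call n) {a c : Fin n} → Between κ a c →
  lastc (σ ∙ κ) a c ≡ (holds σ a , holds σ c)
lastc-∙-between σ κ {a} {c} κ-ac with lastc (σ ∙ κ) a c | lastc-step σ κ a c
... | _ | between _ = refl
... | _ | not-between ¬κ-ac = ⊥-elim (¬κ-ac κ-ac)

lastc-∙-¬between : {n : ℕ} (σ : CallSeq n) (κ : Call n) {a c : Fin n} → ¬ Between κ a c →
  lastc (σ ∙ κ) a c ≡ lastc σ a c
lastc-∙-¬between σ κ {a} {c} ¬κ-ac with lastc (σ ∙ κ) a c | lastc-step σ κ a c
... | _ | between κ-ac = ⊥-elim (¬κ-ac κ-ac)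
... | _ | not-between _ = refl

holds-⊆-∙ : {n : ℕ} (σ : CallSeq n) (κ : Call n) (z : Fin n) → holds σ z ⊆ holds (σ ∙ κ) z
holds-⊆-∙ σ κ z b∈ with holds (σ ∙ κ) z | holds-step σ κ z
... | _ | party (inj₁ refl) = p⊆p∪q _ b∈
... | _ | party (inj₂ refl) = q⊆p∪q _ _ b∈
... | _ | nonparty _ _     = b∈

own∈holds : {n : ℕ} (σ : CallSeq n) (a : Fin n) → a ∈ holds σ a
own∈holds ε       a = x∈⁅x⁆ a
own∈holds (σ ∙ κ) a = holds-⊆-∙ σ κ a (own∈holds σ a)

holds-partner-⊆-∙ : {n : ℕ} (σ : CallSeq n) (κ : Call n) {a c : Fin n} → Between κ a c →
  holds σ c ⊆ holds (σ ∙ κ) a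
holds-partner-⊆-∙ σ κ (inj₁ (refl , refl)) b∈ =
  subst (_ ∈_) (sym (holds-∙-party σ κ (inj₁ refl))) (q⊆p∪q _ _ b∈)
holds-partner-⊆-∙ σ κ (inj₂ (refl , refl)) b∈ =
  subst (_ ∈_) (sym (holds-∙-party σ κ (inj₂ refl))) (p⊆p∪q _ b∈)

received⊆holds-partner : {n : ℕ} (σ : CallSeq n) (a c : Fin n) → proj₂ (lastc σ a c) ⊆ holds σ c
received⊆holds-partner ε a c b∈ = ⊥-elim (∉⊥ b∈)
received⊆holds-partner (σ ∙ κ) a c b∈ with lastc (σ ∙ κ) a c | lastc-step σ κ a c
... | _ | between _     = holds-⊆-∙ σ κ c b∈
... | _ | not-between _ = holds-⊆-∙ σ κ c (received⊆holds-partner σ a c b∈)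

received⊆holds : {n : ℕ} (σ : CallSeq n) (a c : Fin n) → proj₂ (lastc σ a c) ⊆ holds σ a
received⊆holds ε a c b∈ = ⊥-elim (∉⊥ b∈)
received⊆holds (σ ∙ κ) a c b∈ with lastc (σ ∙ κ) a c | lastc-step σ κ a c
... | _ | between κ-ac  = holds-partner-⊆-∙ σ κ κ-ac b∈
... | _ | not-between _ = holds-⊆-∙ σ κ a (received⊆holds σ a c b∈)

⊨ˡ-sec⇒⊨-sec : {n : ℕ} (σ : CallSeq n) {a b : Fin n} → σ ⊨ˡ sec b a → σ ⊨ sec b a
⊨ˡ-sec⇒⊨-sec σ (inj₁ refl)               = own∈holds σ _
⊨ˡ-sec⇒⊨-sec σ (inj₂ (c , _ , b∈received)) = received⊆holds σ _ c b∈received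

SameLast-refl : {n : ℕ} {a : Fin n} (σ : CallSeq n) → SameLast a σ σ
SameLast-refl σ _ _ = refl

SameLast-sym : {n : ℕ} {a : Fin n} (σ τ : CallSeq n) → SameLast a σ τ → SameLast a τ σ
SameLast-sym σ τ same c c≢a = sym (same c c≢a)

SameLast-trans : {n : ℕ} {a : Fin n} (σ τ ρ : CallSeq n) →
  SameLast a σ τ → SameLast a τ ρ → SameLast a σ ρ
SameLast-trans σ τ ρ same same′ c c≢a = trans (same c c≢a) (same′ c c≢a)

SameLast-∙-nonparty : {n : ℕ} {a : Fin n} (σ : CallSeq n) (κ : Call n) →
  caller κ ≢ a → callee κ ≢ a → SameLast a (σ ∙ κ) σ
SameLast-∙-nonparty σ κ x≢a y≢a c _ =
  lastc-∙-¬between σ κ λ { (inj₁ (x≡a , _)) → x≢a x≡a ; (inj₂ (_ , y≡a)) → y≢a y≡a }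

SameLast⇒⊨ˡ-sec : {n : ℕ} {a b : Fin n} (σ τ : CallSeq n) →
  SameLast a σ τ → σ ⊨ˡ sec b a → τ ⊨ˡ sec b a
SameLast⇒⊨ˡ-sec σ τ same (inj₁ b≡a)                  = inj₁ b≡a
SameLast⇒⊨ˡ-sec σ τ same (inj₂ (c , c≢a , b∈received)) =
  inj₂ (c , c≢a , subst ((_ ∈_) ∘ proj₂) (same c c≢a) b∈received)

⊨ˡ-sec-∙-from-partner : {n : ℕ} (σ : CallSeq n) (κ : Call n) {a w b : Fin n} →
  Between κ a w → b ∈ holds σ w → (σ ∙ κ) ⊨ˡ sec b a
⊨ˡ-sec-∙-from-partner σ κ {w = w} κ-aw b∈w =
  inj₂ (w , Between⇒≢ κ κ-aw , subst ((_ ∈_) ∘ proj₂) (sym (lastc-∙-between σ κ κ-aw)) b∈w)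

⊨ˡ-sec-∙-party : {n : ℕ} (σ : CallSeq n) (κ : Call n) {a w b : Fin n} →
  Between κ a w → σ ⊨ˡ sec b a ⊎ b ∈ holds σ w → (σ ∙ κ) ⊨ˡ sec b a
⊨ˡ-sec-∙-party σ κ κ-aw (inj₂ b∈w)        = ⊨ˡ-sec-∙-from-partner σ κ κ-aw b∈w
⊨ˡ-sec-∙-party σ κ κ-aw (inj₁ (inj₁ b≡a)) = inj₁ b≡a
⊨ˡ-sec-∙-party σ κ {a} {w} κ-aw (inj₁ (inj₂ (c , c≢a , b∈received))) with c ≟ w
... | yes refl = ⊨ˡ-sec-∙-from-partner σ κ κ-aw (received⊆holds-partner σ a c b∈received)
... | no c≢w   =
  inj₂ (c , c≢a , subst ((_ ∈_) ∘ proj₂) (sym (lastc-∙-¬between σ κ ¬κ-ac)) b∈received)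
  where
  ¬κ-ac : ¬ Between κ a c
  ¬κ-ac κ-ac = c≢w (Between-partner-unique κ κ-aw κ-ac c≢a)

⊨-sec⇒⊨ˡ-sec : {n : ℕ} (σ : CallSeq n) {a b : Fin n} → σ ⊨ sec b a → σ ⊨ˡ sec b a
⊨-sec⇒⊨ˡ-sec ε b∈ = inj₁ (x∈⁅y⁆⇒x≡y _ b∈)
⊨-sec⇒⊨ˡ-sec (σ ∙ κ) {a} b∈ with holds (σ ∙ κ) a | holds-step σ κ a
... | _ | party (inj₁ refl) =
  ⊨ˡ-sec-∙-party σ κ (inj₁ (refl , refl)) (map₁ (⊨-sec⇒⊨ˡ-sec σ) (x∈p∪q⁻ _ _ b∈))
... | _ | party (inj₂ refl) =
  ⊨ˡ-sec-∙-party σ κ (inj₂ (refl , refl)) (map₁ (⊨-sec⇒⊨ˡ-sec σ) (swap (x∈p∪q⁻ _ _ b∈)))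
... | _ | nonparty a≢x a≢y =
  SameLast⇒⊨ˡ-sec σ (σ ∙ κ)
    (SameLast-sym (σ ∙ κ) σ (SameLast-∙-nonparty σ κ (a≢x ∘ sym) (a≢y ∘ sym)))
    (⊨-sec⇒⊨ˡ-sec σ b∈)

SameLast⇒holds⊆ : {n : ℕ} {a : Fin n} (σ τ : CallSeq n) → SameLast a σ τ → holds σ a ⊆ holds τ a
SameLast⇒holds⊆ σ τ same = ⊨ˡ-sec⇒⊨-sec τ ∘ SameLast⇒⊨ˡ-sec σ τ same ∘ ⊨-sec⇒⊨ˡ-sec σ

SameLast⇒holds≡ : {n : ℕ} {a : Fin n} (σ τ : CallSeq n) → SameLast a σ τ → holds σ a ≡ holds τ a
SameLast⇒holds≡ σ τ same =
  ⊆-antisym (SameLast⇒holds⊆ σ τ same) (SameLast⇒holds⊆ τ σ (SameLast-sym σ τ same))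

SameLast-∙-party : {n : ℕ} {a b : Fin n} (σ τ : CallSeq n) (κ : Call n) → Between κ a b →
  SameLast a σ τ → holds σ b ≡ holds τ b → SameLast a (σ ∙ κ) (τ ∙ κ)
SameLast-∙-party {a = a} {b} σ τ κ κ-ab same b-same c c≢a with c ≟ b
... | yes refl = begin
  lastc (σ ∙ κ) a c        ≡⟨ lastc-∙-between σ κ κ-ab ⟩
  (holds σ a , holds σ c)  ≡⟨ cong₂ _,_ (SameLast⇒holds≡ σ τ same) b-same ⟩
  (holds τ a , holds τ c)  ≡⟨ lastc-∙-between τ κ κ-ab ⟨
  lastc (τ ∙ κ) a c        ∎
  where open ≡-Reasoning
... | no c≢b = begin
  lastc (σ ∙ κ) a c  ≡⟨ lastc-∙-¬between σ κ ¬κ-ac ⟩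
  lastc σ a c        ≡⟨ same c c≢a ⟩
  lastc τ a c        ≡⟨ lastc-∙-¬between τ κ ¬κ-ac ⟨
  lastc (τ ∙ κ) a c  ∎
  where
  open ≡-Reasoning
  ¬κ-ac : ¬ Between κ a c
  ¬κ-ac κ-ac = c≢b (Between-partner-unique κ κ-ab κ-ac c≢a)

∼⇒SameLast : {n : ℕ} {a : Fin n} {σ τ : CallSeq n} → σ ∼[ a ] τ → SameLast a σ τ
∼⇒SameLast ∼ε = SameLast-refl ε
∼⇒SameLast (∼out {σ = σ} {τ} p σ∼τ b-same) =
  SameLast-∙-party σ τ (call _ _ p) (inj₁ (refl , refl)) (∼⇒SameLast σ∼τ) b-same
∼⇒SameLast (∼in {σ = σ} {τ} p σ∼τ b-same) =
  SameLast-∙-party σ τ (call _ _ p) (inj₂ (refl , refl)) (∼⇒SameLast σ∼τ) b-same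
∼⇒SameLast (∼other {σ = σ} {τ} {c} {d} {f} {g} p q c≢a d≢a f≢a g≢a σ∼τ) =
  SameLast-trans (σ ∙ call c d p) σ (τ ∙ call f g q) (SameLast-∙-nonparty σ (call c d p) c≢a d≢a)
    (SameLast-trans σ τ (τ ∙ call f g q) (∼⇒SameLast σ∼τ)
      (SameLast-sym (τ ∙ call f g q) τ (SameLast-∙-nonparty τ (call f g q) f≢a g≢a)))
∼⇒SameLast {σ = σ} ∼refl = SameLast-refl σ
∼⇒SameLast {σ = σ} {τ} (∼sym τ∼σ) = SameLast-sym τ σ (∼⇒SameLast τ∼σ)
∼⇒SameLast {σ = σ} {ρ} (∼trans {τ = τ} σ∼τ τ∼ρ) =
  SameLast-trans σ τ ρ (∼⇒SameLast σ∼τ) (∼⇒SameLast τ∼ρ)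

module ConjunctionRules {n : ℕ} (Holds : Form n → Set)
  (∧⇔× : ∀ {φ ψ} → Holds (φ ∧ ψ) ⇔ (Holds φ × Holds ψ)) where

  ⋀-intro : ∀ {k} (f : Fin (suc k) → Form n) → (∀ i → Holds (f i)) → Holds (⋀ f)
  ⋀-intro {zero}  f h = h zero
  ⋀-intro {suc k} f h = Equivalence.from ∧⇔× (h zero , ⋀-intro (f ∘ suc) (h ∘ suc))

  ⋀-elim : ∀ {k} (f : Fin (suc k) → Form n) → Holds (⋀ f) → ∀ i → Holds (f i)
  ⋀-elim {zero}  f h zero    = h
  ⋀-elim {suc k} f h zero    = proj₁ (Equivalence.to ∧⇔× h)
  ⋀-elim {suc k} f h (suc i) = ⋀-elim (f ∘ suc) (proj₂ (Equivalence.to ∧⇔× h)) i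

module ExpRules {k : ℕ} (Holds : Form (suc k) → Set)
  (∧⇔× : ∀ {φ ψ} → Holds (φ ∧ ψ) ⇔ (Holds φ × Holds ψ)) where

  open ConjunctionRules Holds ∧⇔× public

  Exp-intro : (∀ a b → Holds (sec b a)) → Holds Exp
  Exp-intro h = ⋀-intro _ λ a → ⋀-intro _ λ b → h a b

  Exp-elim : Holds Exp → ∀ a b → Holds (sec b a)
  Exp-elim h a b = ⋀-elim _ (⋀-elim _ h a) b

module ⊨-Rules {k : ℕ} (σ : CallSeq (suc k)) = ExpRules (σ ⊨_) (⇔-id _)
module ⊨ˡ-Rules {k : ℕ} (σ : CallSeq (suc k)) = ExpRules (σ ⊨ˡ_) (⇔-id _)

⊨⇔⊨ˡ-Exp : {k : ℕ} (σ : CallSeq (suc k)) → (σ ⊨ Exp) ⇔ (σ ⊨ˡ Exp)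
⊨⇔⊨ˡ-Exp σ = mk⇔
  (λ h → ⊨ˡ-Rules.Exp-intro σ λ a b → ⊨-sec⇒⊨ˡ-sec σ (⊨-Rules.Exp-elim σ h a b))
  (λ h → ⊨-Rules.Exp-intro σ λ a b → ⊨ˡ-sec⇒⊨-sec σ (⊨ˡ-Rules.Exp-elim σ h a b))

⊨ˡ-K-Exp⇒⊨-K-Exp : {k : ℕ} (σ : CallSeq (suc k)) (a : Fin (suc k)) → σ ⊨ˡ K a Exp → σ ⊨ K a Exp
⊨ˡ-K-Exp⇒⊨-K-Exp σ a knows τ τ∼σ = Equivalence.from (⊨⇔⊨ˡ-Exp τ) (knows τ (∼⇒SameLast τ∼σ))

⊨ˡ-E-Exp⇒⊨-E-Exp : {k : ℕ} (σ : CallSeq (suc k)) → σ ⊨ˡ E Exp → σ ⊨ E Exp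
⊨ˡ-E-Exp⇒⊨-E-Exp σ all-know =
  ⊨-Rules.⋀-intro σ _ λ a → ⊨ˡ-K-Exp⇒⊨-K-Exp σ a (⊨ˡ-Rules.⋀-elim σ _ all-know a)

Observation : ℕ → Set
Observation n = Maybe (Fin n × Fin n × Subset n)

-- An invariant of ∼[ a ]: the calls a takes part in, with the partner's secrets, and,
-- since ∼other matches calls one for one, the mere occurrence of every other call.
observe : {n : ℕ} → Fin n → CallSeq n → List (Observation n)
observe a ε = []
observe a (σ ∙ call x y _) with x ≟ a | y ≟ a
... | yes _ | _     = just (x , y , holds σ y) ∷ observe a σ
... | no _  | yes _ = just (x , y , holds σ x) ∷ observe a σ
... | no _  | no _  = nothing ∷ observe a σ

∼⇒observe≡ : {n : ℕ} {a : Fin n} {σ τ : CallSeq n} → σ ∼[ a ] τ → observe a σ ≡ observe a τ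
∼⇒observe≡ ∼ε = refl
∼⇒observe≡ {a = a} (∼out {b = b} p σ∼τ b-same) with a ≟ a
... | yes _  = cong₂ _∷_ (cong (λ S → just (a , b , S)) b-same) (∼⇒observe≡ σ∼τ)
... | no a≢a = ⊥-elim (a≢a refl)
∼⇒observe≡ {a = a} (∼in {b = b} p σ∼τ b-same) with b ≟ a | a ≟ a
... | yes b≡a | _      = Irrelevant.⊥-elim (p b≡a)
... | no _    | yes _  = cong₂ _∷_ (cong (λ S → just (b , a , S)) b-same) (∼⇒observe≡ σ∼τ)
... | no _    | no a≢a = ⊥-elim (a≢a refl)
∼⇒observe≡ {a = a} (∼other {c = c} {d} {f} {g} p q c≢a d≢a f≢a g≢a σ∼τ)
  with c ≟ a | d ≟ a | f ≟ a | g ≟ a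
... | yes c≡a | _       | _       | _       = ⊥-elim (c≢a c≡a)
... | no _    | yes d≡a | _       | _       = ⊥-elim (d≢a d≡a)
... | no _    | no _    | yes f≡a | _       = ⊥-elim (f≢a f≡a)
... | no _    | no _    | no _    | yes g≡a = ⊥-elim (g≢a g≡a)
... | no _    | no _    | no _    | no _    = cong (nothing ∷_) (∼⇒observe≡ σ∼τ)
∼⇒observe≡ ∼refl = refl
∼⇒observe≡ (∼sym τ∼σ) = sym (∼⇒observe≡ τ∼σ)
∼⇒observe≡ (∼trans σ∼τ τ∼ρ) = trans (∼⇒observe≡ σ∼τ) (∼⇒observe≡ τ∼ρ)

observe≡[]⇒ε : {n : ℕ} (a : Fin n) (σ : CallSeq n) → observe a σ ≡ [] → σ ≡ ε
observe≡[]⇒ε a ε _ = refl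
observe≡[]⇒ε a (σ ∙ call x y p) eq with x ≟ a | y ≟ a
observe≡[]⇒ε a (σ ∙ call x y p) () | yes _ | _
observe≡[]⇒ε a (σ ∙ call x y p) () | no _  | yes _
observe≡[]⇒ε a (σ ∙ call x y p) () | no _  | no _

observe≡just∷-inv : {n : ℕ} (a : Fin n) (σ : CallSeq n) (x y : Fin n) .(p : x ≢ y)
  {u v : Fin n} {S : Subset n} {os : List (Observation n)} →
  observe a (σ ∙ call x y p) ≡ just (u , v , S) ∷ os → x ≡ u × y ≡ v × observe a σ ≡ os
observe≡just∷-inv a σ x y p eq with x ≟ a | y ≟ a
observe≡just∷-inv a σ x y p refl | yes _ | _     = refl , refl , refl
observe≡just∷-inv a σ x y p refl | no _  | yes _ = refl , refl , refl
observe≡just∷-inv a σ x y p ()   | no _  | no _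

observe≡nothing∷-inv : {n : ℕ} (a : Fin n) (σ : CallSeq n) (x y : Fin n) .(p : x ≢ y)
  {os : List (Observation n)} →
  observe a (σ ∙ call x y p) ≡ nothing ∷ os → x ≢ a × y ≢ a × observe a σ ≡ os
observe≡nothing∷-inv a σ x y p eq with x ≟ a | y ≟ a
observe≡nothing∷-inv a σ x y p ()   | yes _ | _
observe≡nothing∷-inv a σ x y p ()   | no _  | yes _
observe≡nothing∷-inv a σ x y p refl | no x≢a | no y≢a = x≢a , y≢a , refl

everyone-holds-all⇒Exp : {k : ℕ} (σ : CallSeq (suc k)) → (∀ z → holds σ z ≡ ⊤) → σ ⊨ Exp
everyone-holds-all⇒Exp σ all = ⊨-Rules.Exp-intro σ λ a b → subst (b ∈_) (sym (all a)) ∈⊤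

-- After 01.02.12 agent 0 knows that all secrets are known, since the only sequences it
-- cannot tell apart are 01.02.12 and 01.02.21.  But its last calls are already those of
-- 01.02, after which agent 1 still lacks the secret of 2.
a₀ a₁ a₂ : Fin 3
a₀ = zero
a₁ = suc zero
a₂ = suc (suc zero)

calls-01 calls-01-02 calls-01-02-12 : CallSeq 3
calls-01       = ε ∙ call a₀ a₁ (λ ())
calls-01-02    = calls-01 ∙ call a₀ a₂ (λ ())
calls-01-02-12 = calls-01-02 ∙ call a₁ a₂ (λ ())

observe≡calls-01 : (τ : CallSeq 3) → observe a₀ τ ≡ observe a₀ calls-01 → τ ≡ calls-01
observe≡calls-01 ε ()
observe≡calls-01 (τ ∙ call x y p) eq with observe≡just∷-inv a₀ τ x y p eq
... | refl , refl , eq′ with observe≡[]⇒ε a₀ τ eq′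
... | refl = refl

observe≡calls-01-02 : (τ : CallSeq 3) → observe a₀ τ ≡ observe a₀ calls-01-02 → τ ≡ calls-01-02
observe≡calls-01-02 ε ()
observe≡calls-01-02 (τ ∙ call x y p) eq with observe≡just∷-inv a₀ τ x y p eq
... | refl , refl , eq′ with observe≡calls-01 τ eq′
... | refl = refl

Exp-after-calls-01-02 : (x y : Fin 3) .(p : x ≢ y) → x ≢ a₀ → y ≢ a₀ →
  (calls-01-02 ∙ call x y p) ⊨ Exp
Exp-after-calls-01-02 zero _ _ x≢a₀ _ = ⊥-elim (x≢a₀ refl)
Exp-after-calls-01-02 _ zero _ _ y≢a₀ = ⊥-elim (y≢a₀ refl)
Exp-after-calls-01-02 (suc zero) (suc zero) p _ _ = Irrelevant.⊥-elim (p refl)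
Exp-after-calls-01-02 (suc zero) (suc (suc zero)) p _ _ =
  everyone-holds-all⇒Exp (calls-01-02 ∙ call a₁ a₂ p)
    λ { zero → refl ; (suc zero) → refl ; (suc (suc zero)) → refl }
Exp-after-calls-01-02 (suc (suc zero)) (suc zero) p _ _ =
  everyone-holds-all⇒Exp (calls-01-02 ∙ call a₂ a₁ p)
    λ { zero → refl ; (suc zero) → refl ; (suc (suc zero)) → refl }
Exp-after-calls-01-02 (suc (suc zero)) (suc (suc zero)) p _ _ = Irrelevant.⊥-elim (p refl)

K-Exp-after-calls-01-02-12 : calls-01-02-12 ⊨ K a₀ Exp
K-Exp-after-calls-01-02-12 τ τ∼ = Exp-from-observation τ (∼⇒observe≡ τ∼)
  where
  Exp-from-observation : (τ : CallSeq 3) → observe a₀ τ ≡ observe a₀ calls-01-02-12 → τ ⊨ Exp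
  Exp-from-observation ε ()
  Exp-from-observation (τ ∙ call x y p) eq with observe≡nothing∷-inv a₀ τ x y p eq
  ... | x≢a₀ , y≢a₀ , eq′ with observe≡calls-01-02 τ eq′
  ... | refl = Exp-after-calls-01-02 x y p x≢a₀ y≢a₀

¬K-Exp-after-calls-01-02-12ˡ : ¬ (calls-01-02-12 ⊨ˡ K a₀ Exp)
¬K-Exp-after-calls-01-02-12ˡ knows =
  a₂∉holds-a₁ (⊨ˡ-sec⇒⊨-sec calls-01-02
    (⊨ˡ-Rules.Exp-elim calls-01-02 (knows calls-01-02 same-last) a₁ a₂))
  where
  same-last : SameLast a₀ calls-01-02 calls-01-02-12
  same-last zero             0≢0 = ⊥-elim (0≢0 refl)
  same-last (suc zero)       _   = refl
  same-last (suc (suc zero)) _   = refl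

  a₂∉holds-a₁ : a₂ ∉ holds calls-01-02 a₁
  a₂∉holds-a₁ (there (there ()))

proposition5 :
      (∀ (m : ℕ) (σ : CallSeq (suc (suc m))) → (σ ⊨ Exp) ⇔ (σ ⊨ˡ Exp))
    × ∃ (λ (m : ℕ) → ∃ (λ (σ : CallSeq (suc (suc m))) → ∃ (λ (a : Fin (suc (suc m))) →
        (σ ⊨ K a Exp) × ¬ (σ ⊨ˡ K a Exp))))
    × (∀ (m : ℕ) (σ : CallSeq (suc (suc m))) (a : Fin (suc (suc m))) →
        σ ⊨ˡ K a Exp → σ ⊨ K a Exp)
    × (∀ (m : ℕ) (σ : CallSeq (suc (suc m))) →
        σ ⊨ˡ E Exp → σ ⊨ E Exp)
proposition5 =
    (λ _ → ⊨⇔⊨ˡ-Exp)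
  , (1 , calls-01-02-12 , a₀ , K-Exp-after-calls-01-02-12 , ¬K-Exp-after-calls-01-02-12ˡ)
  , (λ _ → ⊨ˡ-K-Exp⇒⊨-K-Exp)
  , (λ _ → ⊨ˡ-E-Exp⇒⊨-E-Exp)
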